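{- Let $n\geq 5$ and $0\leq m\leq\binom n2$ be integers. For every simple graph $G$ with $n$ vertices and $m$ edges, $$H(G)+H(\overline G)=\left(n-\tfrac92\right)M_1(G)+h(n,m),$$ where $h(n,m)=2m^2-6\binom n3+(n-1)^2\binom n2-3(n-1)(n-3)m$.
   Context: $\overline G$ is the complement of $G$. $M_1(G)=\sum_v d_G(v)^2$, $M_2(G)=\sum_{uv\in E(G)}d_G(u)d_G(v)$, $k_3(G)$ is the number of triangles, and $H(G)=M_2(G)-6k_3(G)$. -}

module Defs where

open import Data.Nat using (ℕ; _<ᵇ_)
import Data.Nat as ℕ
open import Data.Nat.Combinatorics using (_C_)
open import Data.Bool using (Bool; true; false; if_then_else_; _∧_; not)
open import Data.Fin using (Fin; toℕ; _≟_)
open import Data.List using (List; map; allFin)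
open import Data.Nat.ListAction using (sum)
open import Relation.Binary.PropositionalEquality using (_≡_)
open import Relation.Nullary.Decidable using (⌊_⌋)
open import Data.Integer as ℤ using (ℤ; +_)
open import Data.Rational as ℚ using (ℚ)

Adj : ℕ → Set
Adj n = Fin n → Fin n → Bool

record IsSimple {n : ℕ} (G : Adj n) : Set where
  field
    symmetric : ∀ u v → G u v ≡ G v u
    loopless  : ∀ u → G u u ≡ false

Σv : {n : ℕ} → (Fin n → ℕ) → ℕ
Σv {n} f = sum (map f (allFin n))

compl : {n : ℕ} → Adj n → Adj n
compl G u v = not (G u v) ∧ not ⌊ u ≟ v ⌋

[_] : Bool → ℕ
[ b ] = if b then 1 else 0

lt : {n : ℕ} → Fin n → Fin n → Bool
lt u v = toℕ u <ᵇ toℕ v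

degree : {n : ℕ} → Adj n → Fin n → ℕ
degree G v = Σv (λ u → [ G u v ])

edges : {n : ℕ} → Adj n → ℕ
edges G = Σv (λ u → Σv (λ v → [ lt u v ∧ G u v ]))

M1 : {n : ℕ} → Adj n → ℕ
M1 G = Σv (λ v → degree G v ℕ.* degree G v)

M2 : {n : ℕ} → Adj n → ℕ
M2 G = Σv (λ u → Σv (λ v →
         if lt u v ∧ G u v then degree G u ℕ.* degree G v else 0))

k3 : {n : ℕ} → Adj n → ℕ
k3 G = Σv (λ u → Σv (λ v → Σv (λ w →
         [ lt u v ∧ lt v w ∧ G u v ∧ G v w ∧ G u w ])))

H : {n : ℕ} → Adj n → ℤ
H G = + M2 G ℤ.- + (6 ℕ.* k3 G)

h : ℕ → ℕ → ℤ
h n m = + (2 ℕ.* m ℕ.* m) ℤ.- + (6 ℕ.* (n C 3))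
        ℤ.+ (+ n ℤ.- + 1) ℤ.* (+ n ℤ.- + 1) ℤ.* + (n C 2)
        ℤ.- + 3 ℤ.* (+ n ℤ.- + 1) ℤ.* (+ n ℤ.- + 3) ℤ.* + m

ι : ℤ → ℚ
ι z = z ℚ./ 1

-- Let A be the adjacency matrix of G, d = A𝟙 its degree vector and K = J − I the adjacency
-- matrix of Kₙ.  Counting over ordered pairs and triples of vertices, 2·M₂(G) = dᵀAd and
-- 6·k₃(G) = tr A³, so 2·H(G) = dᵀAd − 2·tr A³.  The complement has adjacency matrix K − A and
-- degree vector (n − 1)𝟙 − d; expanding dᵀ(K − A)d̄ bilinearly and tr (K − A)³ by cyclicity of
-- the trace expresses 2·H(Ḡ) through n, Σd = 2m, M₁ = Σd², dᵀAd and tr A³.  The last two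
-- cancel against 2·H(G), leaving a polynomial identity in n, m and M₁.
module Submission where

open import Defs
open import Data.Nat using (ℕ; _≤_)
open import Data.Nat.Combinatorics using (_C_)
open import Data.Integer using (+_)
open import Relation.Binary.PropositionalEquality using (_≡_; refl; trans)

-- The integer operators are opened only inside this module, so that the rational ones are
-- unambiguous in the statement of lemma13.
module _ where
  open import Data.Nat as ℕ using (zero; suc)
  open import Data.Nat.Combinatorics using (nC1≡n; nCk+nC[k+1]≡[n+1]C[k+1])
  open import Data.Nat.ListAction using () renaming (sum to sumᴸ)
  open import Data.Bool using (Bool; true; false; _∧_; not; if_then_else_)
  open import Data.Fin using (Fin; zero; suc; _≟_)
  open import Data.Integer using (ℤ; 0ℤ; 1ℤ; _+_; _*_; -_; _-_)
  import Data.Integer.Properties as ℤ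
  open import Data.Integer.Tactic.RingSolver using (solve-∀)
  open import Data.List using (tabulate)
  open import Data.List.Properties using (map-tabulate)
  open import Algebra.Properties.Semiring.Sum ℤ.+-*-semiring
    using (sum; sum-syntax; sum-cong-≗; sum-replicate-zero; ∑-distrib-+; ∑-comm; *-distribˡ-sum; *-distribʳ-sum)
  open import Relation.Binary.PropositionalEquality hiding ([_])
  open import Relation.Nullary.Decidable using (⌊_⌋; yes; no; ⌊⌋-map′; isYes≗does; dec-true; dec-false)
  open ≡-Reasoning

  private variable
    n : ℕ

  ∑-const : ∀ n (c : ℤ) → ∑[ i < n ] c ≡ + n * c
  ∑-const zero    c = sym (ℤ.*-zeroˡ c)
  ∑-const (suc n) c = begin
    c + ∑[ i < n ] c  ≡⟨ cong₂ _+_ (sym (ℤ.*-identityˡ c)) (∑-const n c) ⟩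
    1ℤ * c + + n * c  ≡⟨ ℤ.*-distribʳ-+ c 1ℤ (+ n) ⟨
    + suc n * c       ∎

  ∑-neg : (f : Fin n → ℤ) → ∑[ i < n ] (- f i) ≡ - sum f
  ∑-neg {zero}  f = refl
  ∑-neg {suc n} f = trans (cong (_+_ (- f zero)) (∑-neg (λ i → f (suc i))))
                          (sym (ℤ.neg-distrib-+ (f zero) _))

  ∑-sub : (f g : Fin n → ℤ) → ∑[ i < n ] (f i - g i) ≡ sum f - sum g
  ∑-sub f g = trans (∑-distrib-+ f (λ i → - g i)) (cong (_+_ (sum f)) (∑-neg g))

  ∑-*ˡ : (c : ℤ) (f : Fin n → ℤ) → ∑[ i < n ] (c * f i) ≡ c * sum f
  ∑-*ˡ c f = sym (*-distribˡ-sum c f)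

  ∑-*ʳ : (c : ℤ) (f : Fin n → ℤ) → ∑[ i < n ] (f i * c) ≡ sum f * c
  ∑-*ʳ c f = sym (*-distribʳ-sum c f)

  Matrix : ℕ → Set
  Matrix n = Fin n → Fin n → ℤ

  total : Matrix n → ℤ
  total {n} X = ∑[ u < n ] ∑[ v < n ] X u v

  total-cong : {X Y : Matrix n} → (∀ u v → X u v ≡ Y u v) → total X ≡ total Y
  total-cong e = sum-cong-≗ (λ u → sum-cong-≗ (e u))

  total-+ : (X Y : Matrix n) → total (λ u v → X u v + Y u v) ≡ total X + total Y
  total-+ X Y = trans (sum-cong-≗ (λ u → ∑-distrib-+ (X u) (Y u)))
                      (∑-distrib-+ (λ u → sum (X u)) (λ u → sum (Y u)))

  total-sub : (X Y : Matrix n) → total (λ u v → X u v - Y u v) ≡ total X - total Y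
  total-sub X Y = trans (sum-cong-≗ (λ u → ∑-sub (X u) (Y u)))
                        (∑-sub (λ u → sum (X u)) (λ u → sum (Y u)))

  total-*ˡ : (c : ℤ) (X : Matrix n) → total (λ u v → c * X u v) ≡ c * total X
  total-*ˡ c X = trans (sum-cong-≗ (λ u → ∑-*ˡ c (X u))) (∑-*ˡ c (λ u → sum (X u)))

  total-transpose : (X : Matrix n) → total (λ u v → X v u) ≡ total X
  total-transpose X = sym (∑-comm X)

  ∑³ : (Fin n → Fin n → Fin n → ℤ) → ℤ
  ∑³ f = total (λ u v → sum (f u v))

  ∑³-cong : {f g : Fin n → Fin n → Fin n → ℤ} → (∀ u v w → f u v w ≡ g u v w) → ∑³ f ≡ ∑³ g
  ∑³-cong e = total-cong (λ u v → sum-cong-≗ (e u v))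

  ∑³-+ : (f g : Fin n → Fin n → Fin n → ℤ) → ∑³ (λ u v w → f u v w + g u v w) ≡ ∑³ f + ∑³ g
  ∑³-+ f g = trans (total-cong (λ u v → ∑-distrib-+ (f u v) (g u v)))
                   (total-+ (λ u v → sum (f u v)) (λ u v → sum (g u v)))

  ∑³-swap₂₃ : (f : Fin n → Fin n → Fin n → ℤ) → ∑³ f ≡ ∑³ (λ u v w → f u w v)
  ∑³-swap₂₃ f = sum-cong-≗ (λ u → ∑-comm (f u))

  ∑³-rotate : (f : Fin n → Fin n → Fin n → ℤ) → ∑³ f ≡ ∑³ (λ u v w → f v w u)
  ∑³-rotate {n} f = sym (trans (∑-comm (λ u v → ∑[ w < n ] f v w u))
                               (sum-cong-≗ (λ v → ∑-comm (λ u w → f v w u))))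

  ⟦_⟧ : Bool → ℤ
  ⟦ b ⟧ = + [ b ]

  ⟦∧⟧ : ∀ x y → ⟦ x ∧ y ⟧ ≡ ⟦ x ⟧ * ⟦ y ⟧
  ⟦∧⟧ true  true  = refl
  ⟦∧⟧ true  false = refl
  ⟦∧⟧ false y     = refl

  ⟦⟧-idem : ∀ x → ⟦ x ⟧ * ⟦ x ⟧ ≡ ⟦ x ⟧
  ⟦⟧-idem true  = refl
  ⟦⟧-idem false = refl

  ⟦if⟧ : ∀ b k → + (if b then k else 0) ≡ ⟦ b ⟧ * + k
  ⟦if⟧ true  k = sym (ℤ.*-identityˡ (+ k))
  ⟦if⟧ false k = refl

  δ : Matrix n
  δ u v = ⟦ ⌊ u ≟ v ⌋ ⟧

  δ-suc : (u v : Fin n) → δ (suc u) (suc v) ≡ δ u v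
  δ-suc u v = cong ⟦_⟧ (⌊⌋-map′ _ _ (u ≟ v))

  ≟-refl : (u : Fin n) → ⌊ u ≟ u ⌋ ≡ true
  ≟-refl u = trans (isYes≗does (u ≟ u)) (dec-true (u ≟ u) refl)

  ≟-sym : (u v : Fin n) → ⌊ u ≟ v ⌋ ≡ ⌊ v ≟ u ⌋
  ≟-sym u v with u ≟ v
  ... | yes refl = sym (≟-refl u)
  ... | no  u≢v  = sym (trans (isYes≗does (v ≟ u)) (dec-false (v ≟ u) (λ v≡u → u≢v (sym v≡u))))

  δ-refl : (u : Fin n) → δ u u ≡ 1ℤ
  δ-refl u = cong ⟦_⟧ (≟-refl u)

  δ-sym : (u v : Fin n) → δ u v ≡ δ v u
  δ-sym u v = cong ⟦_⟧ (≟-sym u v)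

  δ-* : (u v : Fin n) (x : ℤ) → (u ≡ v → x ≡ 0ℤ) → δ u v * x ≡ 0ℤ
  δ-* u v x x≡0 with u ≟ v
  ... | yes u≡v = trans (ℤ.*-identityˡ x) (x≡0 u≡v)
  ... | no  _   = refl

  ∑-δ : (u : Fin n) (f : Fin n → ℤ) → ∑[ v < n ] (δ u v * f v) ≡ f u
  ∑-δ {suc n} zero    f = begin
    1ℤ * f zero + ∑[ v < n ] 0ℤ  ≡⟨ cong₂ _+_ (ℤ.*-identityˡ (f zero)) (sum-replicate-zero n) ⟩
    f zero + 0ℤ                  ≡⟨ ℤ.+-identityʳ (f zero) ⟩
    f zero                       ∎
  ∑-δ {suc n} (suc u) f = begin
    0ℤ + ∑[ v < n ] (δ (suc u) (suc v) * f (suc v))  ≡⟨ ℤ.+-identityˡ _ ⟩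
    ∑[ v < n ] (δ (suc u) (suc v) * f (suc v))       ≡⟨ sum-cong-≗ (λ v → cong (_* f (suc v)) (δ-suc u v)) ⟩
    ∑[ v < n ] (δ u v * f (suc v))                   ≡⟨ ∑-δ u (λ v → f (suc v)) ⟩
    f (suc u)                                        ∎

  ⟦<⟧ : Fin n → Fin n → ℤ
  ⟦<⟧ u v = ⟦ lt u v ⟧

  <-trichotomy : (u v : Fin n) → ⟦<⟧ u v + ⟦<⟧ v u + δ u v ≡ 1ℤ
  <-trichotomy zero    zero    = refl
  <-trichotomy zero    (suc v) = refl
  <-trichotomy (suc u) zero    = refl
  <-trichotomy (suc u) (suc v) = trans (cong (_+_ (⟦<⟧ u v + ⟦<⟧ v u)) (δ-suc u v)) (<-trichotomy u v)

  <-trans : (u v w : Fin n) → ⟦<⟧ u v * ⟦<⟧ v w * ⟦<⟧ u w ≡ ⟦<⟧ u v * ⟦<⟧ v w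
  <-trans zero    zero    w       = refl
  <-trans zero    (suc v) zero    = refl
  <-trans zero    (suc v) (suc w) = ℤ.*-identityʳ (1ℤ * ⟦<⟧ v w)
  <-trans (suc u) zero    w       = refl
  <-trans (suc u) (suc v) zero    = trans (cong (_* 0ℤ) (ℤ.*-zeroʳ (⟦<⟧ u v))) (sym (ℤ.*-zeroʳ (⟦<⟧ u v)))
  <-trans (suc u) (suc v) (suc w) = <-trans u v w

  -- Relative to u < v, a third vertex w lies after v, between them, before u, or on u or v.
  <-third : (u v w : Fin n) →
    ⟦<⟧ u v * (⟦<⟧ v w + ⟦<⟧ u w * ⟦<⟧ w v + ⟦<⟧ w u + δ w u + δ w v) ≡ ⟦<⟧ u v
  <-third zero    zero    w       = refl
  <-third zero    (suc v) zero    = refl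
  <-third zero    (suc v) (suc w) = begin
    1ℤ * (⟦<⟧ v w + 1ℤ * ⟦<⟧ w v + 0ℤ + 0ℤ + δ (suc w) (suc v))
      ≡⟨ simplify (⟦<⟧ v w) (⟦<⟧ w v) (δ (suc w) (suc v)) ⟩
    ⟦<⟧ v w + ⟦<⟧ w v + δ (suc w) (suc v)
      ≡⟨ cong (_+_ (⟦<⟧ v w + ⟦<⟧ w v)) (trans (δ-suc w v) (δ-sym w v)) ⟩
    ⟦<⟧ v w + ⟦<⟧ w v + δ v w
      ≡⟨ <-trichotomy v w ⟩
    1ℤ
      ∎
    where
    simplify : ∀ x y z → 1ℤ * (x + 1ℤ * y + 0ℤ + 0ℤ + z) ≡ x + y + z
    simplify = solve-∀
  <-third (suc u) zero    w       = refl
  <-third (suc u) (suc v) zero    = ℤ.*-identityʳ (⟦<⟧ u v)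
  <-third (suc u) (suc v) (suc w) =
    trans (cong₂ (λ p q → ⟦<⟧ u v * (⟦<⟧ v w + ⟦<⟧ u w * ⟦<⟧ w v + ⟦<⟧ w u + p + q)) (δ-suc w u) (δ-suc w v))
          (<-third u v w)

  <-split : (u v : Fin n) (x : ℤ) → (u ≡ v → x ≡ 0ℤ) → x ≡ ⟦<⟧ u v * x + ⟦<⟧ v u * x
  <-split u v x x≡0 = begin
    x                                      ≡⟨ ℤ.*-identityˡ x ⟨
    1ℤ * x                                 ≡⟨ cong (_* x) (<-trichotomy u v) ⟨
    (⟦<⟧ u v + ⟦<⟧ v u + δ u v) * x        ≡⟨ distrib (⟦<⟧ u v) (⟦<⟧ v u) (δ u v) x ⟩
    ⟦<⟧ u v * x + ⟦<⟧ v u * x + δ u v * x  ≡⟨ cong (_+_ (⟦<⟧ u v * x + ⟦<⟧ v u * x)) (δ-* u v x x≡0) ⟩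
    ⟦<⟧ u v * x + ⟦<⟧ v u * x + 0ℤ         ≡⟨ ℤ.+-identityʳ _ ⟩
    ⟦<⟧ u v * x + ⟦<⟧ v u * x              ∎
    where
    distrib : ∀ p q r x → (p + q + r) * x ≡ p * x + q * x + r * x
    distrib = solve-∀

  <-split₃ : (u v w : Fin n) (x : ℤ) → (w ≡ u → x ≡ 0ℤ) → (w ≡ v → x ≡ 0ℤ) →
    ⟦<⟧ u v * x ≡ ⟦<⟧ u v * ⟦<⟧ v w * x + ⟦<⟧ u w * ⟦<⟧ w v * x + ⟦<⟧ w u * ⟦<⟧ u v * x
  <-split₃ u v w x x≡0ᵤ x≡0ᵥ = begin
    ⟦<⟧ u v * x
      ≡⟨ cong (_* x) (<-third u v w) ⟨
    ⟦<⟧ u v * (⟦<⟧ v w + ⟦<⟧ u w * ⟦<⟧ w v + ⟦<⟧ w u + δ w u + δ w v) * x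
      ≡⟨ distrib (⟦<⟧ u v) (⟦<⟧ v w) (⟦<⟧ u w) (⟦<⟧ w v) (⟦<⟧ w u) (δ w u) (δ w v) x ⟩
    ⟦<⟧ u v * ⟦<⟧ v w * x + ⟦<⟧ u w * ⟦<⟧ w v * ⟦<⟧ u v * x + ⟦<⟧ w u * ⟦<⟧ u v * x
      + ⟦<⟧ u v * (δ w u * x + δ w v * x)
      ≡⟨ cong₂ (λ p q → ⟦<⟧ u v * ⟦<⟧ v w * x + p * x + ⟦<⟧ w u * ⟦<⟧ u v * x + ⟦<⟧ u v * q)
               (<-trans u w v) (cong₂ _+_ (δ-* w u x x≡0ᵤ) (δ-* w v x x≡0ᵥ)) ⟩
    ⟦<⟧ u v * ⟦<⟧ v w * x + ⟦<⟧ u w * ⟦<⟧ w v * x + ⟦<⟧ w u * ⟦<⟧ u v * x + ⟦<⟧ u v * (0ℤ + 0ℤ)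
      ≡⟨ drop-zero (⟦<⟧ u v * ⟦<⟧ v w * x) (⟦<⟧ u w * ⟦<⟧ w v * x) (⟦<⟧ w u * ⟦<⟧ u v * x) (⟦<⟧ u v) ⟩
    ⟦<⟧ u v * ⟦<⟧ v w * x + ⟦<⟧ u w * ⟦<⟧ w v * x + ⟦<⟧ w u * ⟦<⟧ u v * x
      ∎
    where
    distrib : ∀ p q r s t e₁ e₂ x →
      p * (q + r * s + t + e₁ + e₂) * x ≡ p * q * x + r * s * p * x + t * p * x + p * (e₁ * x + e₂ * x)
    distrib = solve-∀
    drop-zero : ∀ a b c p → a + b + c + p * (0ℤ + 0ℤ) ≡ a + b + c
    drop-zero = solve-∀

  total-symmetric : (X : Matrix n) → (∀ u v → X u v ≡ X v u) → (∀ u → X u u ≡ 0ℤ) →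
    total X ≡ + 2 * total (λ u v → ⟦<⟧ u v * X u v)
  total-symmetric X symmetric loopless = begin
    total X
      ≡⟨ total-cong (λ u v → <-split u v (X u v) (λ { refl → loopless u })) ⟩
    total (λ u v → ⟦<⟧ u v * X u v + ⟦<⟧ v u * X u v)
      ≡⟨ total-+ (λ u v → ⟦<⟧ u v * X u v) (λ u v → ⟦<⟧ v u * X u v) ⟩
    total (λ u v → ⟦<⟧ u v * X u v) + total (λ u v → ⟦<⟧ v u * X u v)
      ≡⟨ cong (_+_ (total (λ u v → ⟦<⟧ u v * X u v))) (trans (total-transpose (λ u v → ⟦<⟧ u v * X v u))
           (total-cong (λ u v → cong (_*_ (⟦<⟧ u v)) (symmetric v u)))) ⟩
    total (λ u v → ⟦<⟧ u v * X u v) + total (λ u v → ⟦<⟧ u v * X u v)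
      ≡⟨ double _ ⟩
    + 2 * total (λ u v → ⟦<⟧ u v * X u v)
      ∎
    where
    double : ∀ x → x + x ≡ + 2 * x
    double = solve-∀

  ∑³-symmetric : (f : Fin n → Fin n → Fin n → ℤ) →
    (∀ u v w → f u v w ≡ f v u w) → (∀ u v w → f u v w ≡ f u w v) → (∀ u w → f u u w ≡ 0ℤ) →
    ∑³ f ≡ + 6 * ∑³ (λ u v w → ⟦<⟧ u v * ⟦<⟧ v w * f u v w)
  ∑³-symmetric {n} f swap₁₂ swap₂₃ vanish = begin
    ∑³ f
      ≡⟨ total-symmetric (λ u v → sum (f u v)) (λ u v → sum-cong-≗ (swap₁₂ u v))
           (λ u → trans (sum-cong-≗ (vanish u)) (sum-replicate-zero n)) ⟩
    + 2 * total (λ u v → ⟦<⟧ u v * sum (f u v))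
      ≡⟨ cong (_*_ (+ 2)) (total-cong (λ u v → sym (∑-*ˡ (⟦<⟧ u v) (f u v)))) ⟩
    + 2 * ∑³ (λ u v w → ⟦<⟧ u v * f u v w)
      ≡⟨ cong (_*_ (+ 2)) (∑³-cong (λ u v w → <-split₃ u v w (f u v w)
           (λ { refl → trans (swap₂₃ w v w) (vanish w v) })
           (λ { refl → trans (swap₁₂ u w w) (trans (swap₂₃ w u w) (vanish w u)) }))) ⟩
    + 2 * ∑³ (λ u v w → ordered u v w + middle u v w + first u v w)
      ≡⟨ cong (_*_ (+ 2)) (trans (∑³-+ (λ u v w → ordered u v w + middle u v w) first)
                                 (cong (_+ ∑³ first) (∑³-+ ordered middle))) ⟩
    + 2 * (∑³ ordered + ∑³ middle + ∑³ first)
      ≡⟨ cong₂ (λ p q → + 2 * (∑³ ordered + p + q))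
           (trans (∑³-swap₂₃ middle) (∑³-cong (λ u v w → cong (_*_ (⟦<⟧ u v * ⟦<⟧ v w)) (swap₂₃ u w v))))
           (trans (∑³-rotate first) (∑³-cong (λ u v w → cong (_*_ (⟦<⟧ u v * ⟦<⟧ v w))
             (trans (swap₂₃ v w u) (swap₁₂ v u w))))) ⟩
    + 2 * (∑³ ordered + ∑³ ordered + ∑³ ordered)
      ≡⟨ triple (∑³ ordered) ⟩
    + 6 * ∑³ ordered
      ∎
    where
    ordered middle first : Fin n → Fin n → Fin n → ℤ
    ordered u v w = ⟦<⟧ u v * ⟦<⟧ v w * f u v w
    middle  u v w = ⟦<⟧ u w * ⟦<⟧ w v * f u v w
    first   u v w = ⟦<⟧ w u * ⟦<⟧ u v * f u v w
    triple : ∀ x → + 2 * (x + x + x) ≡ + 6 * x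
    triple = solve-∀

  infixl 6 _⊖_
  infixl 7 _·_

  _⊖_ : Matrix n → Matrix n → Matrix n
  (X ⊖ Y) u v = X u v - Y u v

  _·_ : Matrix n → Matrix n → Matrix n
  _·_ {n} X Y u v = ∑[ w < n ] (X u w * Y w v)

  complete : Matrix n
  complete u v = 1ℤ - δ u v

  deg : Matrix n → Fin n → ℤ
  deg {n} X v = ∑[ u < n ] X u v

  trace : Matrix n → ℤ
  trace {n} X = ∑[ u < n ] X u u

  form : Matrix n → (Fin n → ℤ) → (Fin n → ℤ) → ℤ
  form X x y = total (λ u v → X u v * (x u * y v))

  tr³ : Matrix n → Matrix n → Matrix n → ℤ
  tr³ X Y Z = total (λ u v → X u v * (Y · Z) v u)

  ∑-complete : (u : Fin n) (f : Fin n → ℤ) → ∑[ v < n ] (complete u v * f v) ≡ sum f - f u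
  ∑-complete {n} u f = begin
    ∑[ v < n ] (complete u v * f v)   ≡⟨ sum-cong-≗ (λ v → distrib (δ u v) (f v)) ⟩
    ∑[ v < n ] (f v - δ u v * f v)    ≡⟨ ∑-sub f (λ v → δ u v * f v) ⟩
    sum f - ∑[ v < n ] (δ u v * f v)  ≡⟨ cong (_-_ (sum f)) (∑-δ u f) ⟩
    sum f - f u                       ∎
    where
    distrib : ∀ e x → (1ℤ - e) * x ≡ x - e * x
    distrib = solve-∀

  sum-deg : (X : Matrix n) → sum (deg X) ≡ total X
  sum-deg X = sym (∑-comm X)

  deg-⊖ : (X Y : Matrix n) (v : Fin n) → deg (X ⊖ Y) v ≡ deg X v - deg Y v
  deg-⊖ X Y v = ∑-sub (λ u → X u v) (λ u → Y u v)

  deg-complete : (v : Fin n) → deg complete v ≡ + n - 1ℤ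
  deg-complete {n} v = begin
    ∑[ u < n ] (1ℤ - δ u v)           ≡⟨ ∑-sub (λ _ → 1ℤ) (λ u → δ u v) ⟩
    ∑[ u < n ] 1ℤ - ∑[ u < n ] δ u v  ≡⟨ cong₂ _-_ (trans (∑-const n 1ℤ) (ℤ.*-identityʳ (+ n))) column ⟩
    + n - 1ℤ                          ∎
    where
    column : ∑[ u < n ] δ u v ≡ 1ℤ
    column = trans (sum-cong-≗ (λ u → trans (δ-sym u v) (sym (ℤ.*-identityʳ (δ v u))))) (∑-δ v (λ _ → 1ℤ))

  total-complete : total (complete {n}) ≡ + n * (+ n - 1ℤ)
  total-complete {n} =
    trans (sym (sum-deg (complete {n}))) (trans (sum-cong-≗ (deg-complete {n})) (∑-const n (+ n - 1ℤ)))

  trace-complete : trace (complete {n}) ≡ 0ℤ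
  trace-complete {n} = trans (sum-cong-≗ {n} (λ u → cong (_-_ 1ℤ) (δ-refl u))) (sum-replicate-zero n)

  complete·-entry : (X : Matrix n) (u v : Fin n) → (complete · X) u v ≡ deg X v - X u v
  complete·-entry X u v = ∑-complete u (λ w → X w v)

  total-complete· : (X : Matrix n) → total (complete · X) ≡ (+ n - 1ℤ) * total X
  total-complete· {n} X = begin
    total (complete · X)              ≡⟨ total-cong (complete·-entry X) ⟩
    total (λ u v → deg X v - X u v)   ≡⟨ total-sub (λ _ v → deg X v) X ⟩
    ∑[ u < n ] sum (deg X) - total X  ≡⟨ cong (_- total X) (∑-const n (sum (deg X))) ⟩
    + n * sum (deg X) - total X       ≡⟨ cong (λ t → + n * t - total X) (sum-deg X) ⟩
    + n * total X - total X           ≡⟨ factor (+ n) (total X) ⟩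
    (+ n - 1ℤ) * total X              ∎
    where
    factor : ∀ k t → k * t - t ≡ (k - 1ℤ) * t
    factor = solve-∀

  trace-complete· : (X : Matrix n) → trace (complete · X) ≡ total X - trace X
  trace-complete· X = trans (sum-cong-≗ (λ u → complete·-entry X u u))
                            (trans (∑-sub (deg X) (λ u → X u u)) (cong (_- trace X) (sum-deg X)))

  tr³-complete : (Y Z : Matrix n) → tr³ complete Y Z ≡ total (Y · Z) - trace (Y · Z)
  tr³-complete Y Z = trans (sum-cong-≗ (λ u → ∑-complete u (λ v → (Y · Z) v u)))
                           (trans (∑-sub (deg (Y · Z)) (λ u → (Y · Z) u u))
                                  (cong (_- trace (Y · Z)) (sum-deg (Y · Z))))

  tr³-∑³ : (X Y Z : Matrix n) → tr³ X Y Z ≡ ∑³ (λ u v w → X u v * (Y v w * Z w u))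
  tr³-∑³ X Y Z = total-cong (λ u v → sym (∑-*ˡ (X u v) (λ w → Y v w * Z w u)))

  tr³-rotate : (X Y Z : Matrix n) → tr³ X Y Z ≡ tr³ Z X Y
  tr³-rotate X Y Z = begin
    tr³ X Y Z                                     ≡⟨ tr³-∑³ X Y Z ⟩
    ∑³ (λ u v w → X u v * (Y v w * Z w u))        ≡⟨ ∑³-rotate (λ u v w → X u v * (Y v w * Z w u)) ⟩
    ∑³ (λ u v w → X v w * (Y w u * Z u v))        ≡⟨ ∑³-cong (λ u v w → rotate (X v w) (Y w u) (Z u v)) ⟩
    ∑³ (λ u v w → Z u v * (X v w * Y w u))        ≡⟨ tr³-∑³ Z X Y ⟨
    tr³ Z X Y                                     ∎
    where
    rotate : ∀ x y z → x * (y * z) ≡ z * (x * y)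
    rotate = solve-∀

  tr³-⊖ˡ : (X X′ Y Z : Matrix n) → tr³ (X ⊖ X′) Y Z ≡ tr³ X Y Z - tr³ X′ Y Z
  tr³-⊖ˡ X X′ Y Z = trans (total-cong (λ u v → distrib (X u v) (X′ u v) ((Y · Z) v u)))
                          (total-sub (λ u v → X u v * (Y · Z) v u) (λ u v → X′ u v * (Y · Z) v u))
    where
    distrib : ∀ x x′ w → (x - x′) * w ≡ x * w - x′ * w
    distrib = solve-∀

  tr³-⊖ᵐ : (X Y Y′ Z : Matrix n) → tr³ X (Y ⊖ Y′) Z ≡ tr³ X Y Z - tr³ X Y′ Z
  tr³-⊖ᵐ X Y Y′ Z = begin
    tr³ X (Y ⊖ Y′) Z            ≡⟨ trans (tr³-rotate X (Y ⊖ Y′) Z) (tr³-rotate Z X (Y ⊖ Y′)) ⟩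
    tr³ (Y ⊖ Y′) Z X            ≡⟨ tr³-⊖ˡ Y Y′ Z X ⟩
    tr³ Y Z X - tr³ Y′ Z X      ≡⟨ cong₂ _-_ (tr³-rotate Y Z X) (tr³-rotate Y′ Z X) ⟩
    tr³ X Y Z - tr³ X Y′ Z      ∎

  tr³-⊖ʳ : (X Y Z Z′ : Matrix n) → tr³ X Y (Z ⊖ Z′) ≡ tr³ X Y Z - tr³ X Y Z′
  tr³-⊖ʳ X Y Z Z′ = begin
    tr³ X Y (Z ⊖ Z′)            ≡⟨ tr³-rotate X Y (Z ⊖ Z′) ⟩
    tr³ (Z ⊖ Z′) X Y            ≡⟨ tr³-⊖ˡ Z Z′ X Y ⟩
    tr³ Z X Y - tr³ Z′ X Y      ≡⟨ cong₂ _-_ (tr³-rotate X Y Z) (tr³-rotate X Y Z′) ⟨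
    tr³ X Y Z - tr³ X Y Z′      ∎

  tr³-cube-⊖ : (X Y : Matrix n) →
    tr³ (X ⊖ Y) (X ⊖ Y) (X ⊖ Y) ≡ tr³ X X X - + 3 * tr³ X X Y + + 3 * tr³ X Y Y - tr³ Y Y Y
  tr³-cube-⊖ X Y = begin
    tr³ (X ⊖ Y) (X ⊖ Y) (X ⊖ Y)
      ≡⟨ tr³-⊖ˡ X Y (X ⊖ Y) (X ⊖ Y) ⟩
    tr³ X (X ⊖ Y) (X ⊖ Y) - tr³ Y (X ⊖ Y) (X ⊖ Y)
      ≡⟨ cong₂ _-_ (expand X) (expand Y) ⟩
    (tr³ X X X - tr³ X X Y - (tr³ X Y X - tr³ X Y Y)) - (tr³ Y X X - tr³ Y X Y - (tr³ Y Y X - tr³ Y Y Y))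
      ≡⟨ collect (tr³ X X X) (tr³ X X Y) (tr³ X Y Y) (tr³ Y Y Y)
           (tr³-rotate X Y X)
           (trans (tr³-rotate Y X X) (tr³-rotate X Y X))
           (trans (tr³-rotate Y X Y) (tr³-rotate Y Y X))
           (tr³-rotate Y Y X) ⟩
    tr³ X X X - + 3 * tr³ X X Y + + 3 * tr³ X Y Y - tr³ Y Y Y
      ∎
    where
    expand : ∀ W → tr³ W (X ⊖ Y) (X ⊖ Y) ≡ tr³ W X X - tr³ W X Y - (tr³ W Y X - tr³ W Y Y)
    expand W = trans (tr³-⊖ᵐ W X Y (X ⊖ Y)) (cong₂ _-_ (tr³-⊖ʳ W X X Y) (tr³-⊖ʳ W Y X Y))
    cube : ∀ a b c d → a - b - (b - c) - (b - c - (c - d)) ≡ a - + 3 * b + + 3 * c - d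
    cube = solve-∀
    collect : ∀ a b c d {b₁ b₂ c₁ c₂} → b₁ ≡ b → b₂ ≡ b → c₁ ≡ c → c₂ ≡ c →
      a - b - (b₁ - c) - (b₂ - c₁ - (c₂ - d)) ≡ a - + 3 * b + + 3 * c - d
    collect a b c d refl refl refl refl = cube a b c d

  tr³-complete² : (X : Matrix n) → tr³ complete complete X ≡ (+ n - + 2) * total X + trace X
  tr³-complete² {n} X = begin
    tr³ complete complete X                      ≡⟨ tr³-complete complete X ⟩
    total (complete · X) - trace (complete · X)  ≡⟨ cong₂ _-_ (total-complete· X) (trace-complete· X) ⟩
    (+ n - 1ℤ) * total X - (total X - trace X)   ≡⟨ simplify (+ n) (total X) (trace X) ⟩
    (+ n - + 2) * total X + trace X              ∎
    where
    simplify : ∀ k t r → (k - 1ℤ) * t - (t - r) ≡ (k - + 2) * t + r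
    simplify = solve-∀

  form-cong : (X : Matrix n) {x x′ y y′ : Fin n → ℤ} → (∀ u → x u ≡ x′ u) → (∀ v → y v ≡ y′ v) →
    form X x y ≡ form X x′ y′
  form-cong X x≗x′ y≗y′ = total-cong (λ u v → cong (_*_ (X u v)) (cong₂ _*_ (x≗x′ u) (y≗y′ v)))

  form-⊖ : (X Y : Matrix n) (x y : Fin n → ℤ) → form (X ⊖ Y) x y ≡ form X x y - form Y x y
  form-⊖ X Y x y = trans (total-cong (λ u v → distrib (X u v) (Y u v) (x u * y v)))
                         (total-sub (λ u v → X u v * (x u * y v)) (λ u v → Y u v * (x u * y v)))
    where
    distrib : ∀ p q r → (p - q) * r ≡ p * r - q * r
    distrib = solve-∀

  form-complete : (x y : Fin n → ℤ) → form complete x y ≡ sum x * sum y - ∑[ u < n ] (x u * y u)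
  form-complete {n} x y = begin
    form complete x y
      ≡⟨ sum-cong-≗ (λ u → ∑-complete u (λ v → x u * y v)) ⟩
    ∑[ u < n ] (∑[ v < n ] (x u * y v) - x u * y u)
      ≡⟨ ∑-sub (λ u → ∑[ v < n ] (x u * y v)) (λ u → x u * y u) ⟩
    ∑[ u < n ] ∑[ v < n ] (x u * y v) - ∑[ u < n ] (x u * y u)
      ≡⟨ cong (_- ∑[ u < n ] (x u * y u)) (trans (sum-cong-≗ (λ u → ∑-*ˡ (x u) y)) (∑-*ʳ (sum y) x)) ⟩
    sum x * sum y - ∑[ u < n ] (x u * y u)
      ∎

  M₁ : Matrix n → ℤ
  M₁ X = sum (λ v → deg X v * deg X v)

  degForm : Matrix n → ℤ
  degForm X = form X (deg X) (deg X)

  cubeTrace : Matrix n → ℤ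
  cubeTrace X = tr³ X X X

  degForm-cong : {X Y : Matrix n} → (∀ u v → X u v ≡ Y u v) → degForm X ≡ degForm Y
  degForm-cong {X = X} {Y} X≗Y =
    total-cong (λ u v → cong₂ _*_ (X≗Y u v) (cong₂ _*_ (deg-cong u) (deg-cong v)))
    where
    deg-cong : ∀ v → deg X v ≡ deg Y v
    deg-cong v = sum-cong-≗ (λ u → X≗Y u v)

  cubeTrace-cong : {X Y : Matrix n} → (∀ u v → X u v ≡ Y u v) → cubeTrace X ≡ cubeTrace Y
  cubeTrace-cong X≗Y =
    total-cong (λ u v → cong₂ _*_ (X≗Y u v) (sum-cong-≗ (λ w → cong₂ _*_ (X≗Y v w) (X≗Y w u))))

  record IsAdjacency (A : Matrix n) : Set where
    field
      symmetric : ∀ u v → A u v ≡ A v u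
      loopless  : ∀ u → A u u ≡ 0ℤ
      boolean   : ∀ u v → A u v * A u v ≡ A u v

  module _ {A : Matrix n} (isAdjacency : IsAdjacency A) where
    open IsAdjacency isAdjacency

    private
      N : ℤ
      N = + n - 1ℤ

    rowsum-deg : ∀ u → sum (A u) ≡ deg A u
    rowsum-deg u = sum-cong-≗ (symmetric u)

    trace-adjacency : trace A ≡ 0ℤ
    trace-adjacency = trans (sum-cong-≗ loopless) (sum-replicate-zero n)

    total-deg-row : total (λ u v → A u v * deg A u) ≡ M₁ A
    total-deg-row = sum-cong-≗ (λ u → trans (∑-*ʳ (deg A u) (A u)) (cong (_* deg A u) (rowsum-deg u)))

    total-deg-col : total (λ u v → A u v * deg A v) ≡ M₁ A
    total-deg-col = trans (total-transpose (λ v u → A u v * deg A v))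
                          (sum-cong-≗ (λ v → ∑-*ʳ (deg A v) (λ u → A u v)))

    total-square : total (A · A) ≡ M₁ A
    total-square =
      trans (∑³-swap₂₃ (λ u v w → A u w * A w v))
            (trans (total-cong (λ u w → trans (∑-*ˡ (A u w) (A w)) (cong (_*_ (A u w)) (rowsum-deg w))))
                   total-deg-col)

    trace-square : trace (A · A) ≡ total A
    trace-square = total-cong (λ u w → trans (cong (_*_ (A u w)) (symmetric w u)) (boolean u w))

    form-deg-shift : (s : ℤ) →
      form A (λ u → s - deg A u) (λ v → s - deg A v) ≡ s * s * total A - (s + s) * M₁ A + degForm A
    form-deg-shift s = begin
      form A (λ u → s - deg A u) (λ v → s - deg A v)
        ≡⟨ total-cong (λ u v → expand s (A u v) (deg A u) (deg A v)) ⟩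
      total (λ u v → constant u v - row u v - column u v + quadratic u v)
        ≡⟨ total-+ (λ u v → constant u v - row u v - column u v) quadratic ⟩
      total (λ u v → constant u v - row u v - column u v) + degForm A
        ≡⟨ cong (_+ degForm A) (trans (total-sub (λ u v → constant u v - row u v) column)
                                      (cong (_- total column) (total-sub constant row))) ⟩
      total constant - total row - total column + degForm A
        ≡⟨ cong₂ (λ p q → p - q - total column + degForm A)
                 (total-*ˡ (s * s) A)
                 (trans (total-*ˡ s (λ u v → A u v * deg A u)) (cong (_*_ s) total-deg-row)) ⟩
      s * s * total A - s * M₁ A - total column + degForm A
        ≡⟨ cong (λ p → s * s * total A - s * M₁ A - p + degForm A)
                (trans (total-*ˡ s (λ u v → A u v * deg A v)) (cong (_*_ s) total-deg-col)) ⟩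
      s * s * total A - s * M₁ A - s * M₁ A + degForm A
        ≡⟨ collect (s * s * total A) s (M₁ A) (degForm A) ⟩
      s * s * total A - (s + s) * M₁ A + degForm A
        ∎
      where
      constant row column quadratic : Matrix n
      constant u v = s * s * A u v
      row      u v = s * (A u v * deg A u)
      column   u v = s * (A u v * deg A v)
      quadratic u v = A u v * (deg A u * deg A v)
      expand : ∀ s a x y → a * ((s - x) * (s - y)) ≡ s * s * a - s * (a * x) - s * (a * y) + a * (x * y)
      expand = solve-∀
      collect : ∀ c s m p → c - s * m - s * m + p ≡ c - (s + s) * m + p
      collect = solve-∀

    deg-complete⊖ : ∀ v → deg (complete ⊖ A) v ≡ N - deg A v
    deg-complete⊖ v = trans (deg-⊖ complete A v) (cong (_- deg A v) (deg-complete v))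

    sum-deg-complete⊖ : sum (deg (complete ⊖ A)) ≡ + n * N - total A
    sum-deg-complete⊖ = trans (sum-cong-≗ deg-complete⊖)
                          (trans (∑-sub (λ _ → N) (deg A)) (cong₂ _-_ (∑-const n N) (sum-deg A)))

    M₁-complete⊖ : M₁ (complete ⊖ A) ≡ + n * (N * N) - (N + N) * total A + M₁ A
    M₁-complete⊖ = begin
      M₁ (complete ⊖ A)
        ≡⟨ sum-cong-≗ (λ v → trans (cong₂ _*_ (deg-complete⊖ v) (deg-complete⊖ v)) (square N (deg A v))) ⟩
      ∑[ v < n ] (N * N - (N + N) * deg A v + deg A v * deg A v)
        ≡⟨ ∑-distrib-+ (λ v → N * N - (N + N) * deg A v) (λ v → deg A v * deg A v) ⟩
      ∑[ v < n ] (N * N - (N + N) * deg A v) + M₁ A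
        ≡⟨ cong (_+ M₁ A) (trans (∑-sub (λ _ → N * N) (λ v → (N + N) * deg A v))
                                 (cong₂ _-_ (∑-const n (N * N)) (∑-*ˡ (N + N) (deg A)))) ⟩
      + n * (N * N) - (N + N) * sum (deg A) + M₁ A
        ≡⟨ cong (λ t → + n * (N * N) - (N + N) * t + M₁ A) (sum-deg A) ⟩
      + n * (N * N) - (N + N) * total A + M₁ A
        ∎
      where
      square : ∀ N x → (N - x) * (N - x) ≡ N * N - (N + N) * x + x * x
      square = solve-∀

    degForm-complete⊖ : degForm (complete ⊖ A) ≡
      (+ n * N - total A) * (+ n * N - total A) - M₁ (complete ⊖ A)
        - (N * N * total A - (N + N) * M₁ A + degForm A)
    degForm-complete⊖ = trans (form-⊖ complete A d̄ d̄) (cong₂ _-_ complete-part adjacency-part)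
      where
      d̄ : Fin n → ℤ
      d̄ = deg (complete ⊖ A)
      complete-part : form complete d̄ d̄ ≡ (+ n * N - total A) * (+ n * N - total A) - M₁ (complete ⊖ A)
      complete-part = trans (form-complete d̄ d̄) (cong (λ t → t * t - M₁ (complete ⊖ A)) sum-deg-complete⊖)
      adjacency-part : form A d̄ d̄ ≡ N * N * total A - (N + N) * M₁ A + degForm A
      adjacency-part = trans (form-cong A deg-complete⊖ deg-complete⊖) (form-deg-shift N)

    cubeTrace-complete⊖ : cubeTrace (complete ⊖ A) ≡
      (+ n - + 2) * (+ n * N) - + 3 * ((+ n - + 2) * total A) + + 3 * (M₁ A - total A) - cubeTrace A
    cubeTrace-complete⊖ = begin
      tr³ (complete ⊖ A) (complete ⊖ A) (complete ⊖ A)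
        ≡⟨ tr³-cube-⊖ complete A ⟩
      tr³ K K K - + 3 * tr³ K K A + + 3 * tr³ K A A - cubeTrace A
        ≡⟨ cong₂ (λ p q → p - + 3 * q + + 3 * tr³ K A A - cubeTrace A) KKK KKA ⟩
      (+ n - + 2) * (+ n * N) - + 3 * ((+ n - + 2) * total A) + + 3 * tr³ K A A - cubeTrace A
        ≡⟨ cong (λ r → (+ n - + 2) * (+ n * N) - + 3 * ((+ n - + 2) * total A) + + 3 * r - cubeTrace A) KAA ⟩
      (+ n - + 2) * (+ n * N) - + 3 * ((+ n - + 2) * total A) + + 3 * (M₁ A - total A) - cubeTrace A
        ∎
      where
      K : Matrix n
      K = complete
      KKK : tr³ K K K ≡ (+ n - + 2) * (+ n * N)
      KKK = trans (tr³-complete² K)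
                  (trans (cong₂ (λ t r → (+ n - + 2) * t + r) (total-complete {n}) (trace-complete {n}))
                         (ℤ.+-identityʳ _))
      KKA : tr³ K K A ≡ (+ n - + 2) * total A
      KKA = trans (tr³-complete² A)
                  (trans (cong (_+_ ((+ n - + 2) * total A)) trace-adjacency) (ℤ.+-identityʳ _))
      KAA : tr³ K A A ≡ M₁ A - total A
      KAA = trans (tr³-complete A A) (cong₂ _-_ total-square trace-square)

  +-sumᴸ-tabulate : (f : Fin n → ℕ) → + sumᴸ (tabulate f) ≡ ∑[ i < n ] (+ f i)
  +-sumᴸ-tabulate {zero}  f = refl
  +-sumᴸ-tabulate {suc n} f =
    trans (ℤ.pos-+ (f zero) _) (cong (_+_ (+ f zero)) (+-sumᴸ-tabulate (λ i → f (suc i))))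

  Σv-sum : (f : Fin n → ℕ) → + Σv f ≡ ∑[ i < n ] (+ f i)
  Σv-sum f = trans (cong (λ xs → + sumᴸ xs) (map-tabulate (λ i → i) f)) (+-sumᴸ-tabulate f)

  Σv²-total : (f : Fin n → Fin n → ℕ) → + Σv (λ u → Σv (f u)) ≡ total (λ u v → + f u v)
  Σv²-total f = trans (Σv-sum (λ u → Σv (f u))) (sum-cong-≗ (λ u → Σv-sum (f u)))

  Σv³-∑³ : (f : Fin n → Fin n → Fin n → ℕ) → + Σv (λ u → Σv (λ v → Σv (f u v))) ≡ ∑³ (λ u v w → + f u v w)
  Σv³-∑³ f = trans (Σv²-total (λ u v → Σv (f u v))) (total-cong (λ u v → Σv-sum (f u v)))

  adjacency : Adj n → Matrix n
  adjacency G u v = ⟦ G u v ⟧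

  degree≡deg : (G : Adj n) (v : Fin n) → + degree G v ≡ deg (adjacency G) v
  degree≡deg G v = Σv-sum (λ u → [ G u v ])

  M1≡M₁ : (G : Adj n) → + M1 G ≡ M₁ (adjacency G)
  M1≡M₁ G = trans (Σv-sum (λ v → degree G v ℕ.* degree G v)) (sum-cong-≗ (λ v →
    trans (ℤ.pos-* (degree G v) (degree G v)) (cong₂ _*_ (degree≡deg G v) (degree≡deg G v))))

  compl-isSimple : {G : Adj n} → IsSimple G → IsSimple (compl G)
  compl-isSimple simple = record
    { symmetric = λ u v → cong₂ (λ g e → not g ∧ not e) (symmetric u v) (≟-sym u v)
    ; loopless  = λ u → cong₂ (λ g e → not g ∧ not e) (loopless u) (≟-refl u)
    }
    where open IsSimple simple

  module _ {G : Adj n} (simple : IsSimple G) where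
    open IsSimple simple

    private
      A : Matrix n
      A = adjacency G

    adjacency-isAdjacency : IsAdjacency A
    adjacency-isAdjacency = record
      { symmetric = λ u v → cong ⟦_⟧ (symmetric u v)
      ; loopless  = λ u → cong ⟦_⟧ (loopless u)
      ; boolean   = λ u v → ⟦⟧-idem (G u v)
      }

    open IsAdjacency adjacency-isAdjacency using () renaming (symmetric to A-symmetric; loopless to A-loopless)

    adjacency-compl : ∀ u v → adjacency (compl G) u v ≡ (complete ⊖ A) u v
    adjacency-compl u v with u ≟ v
    ... | yes refl rewrite loopless u = refl
    ... | no _ with G u v
    ...   | true  = refl
    ...   | false = refl

    edges-total : + 2 * + edges G ≡ total A
    edges-total = begin
      + 2 * + edges G
        ≡⟨ cong (_*_ (+ 2)) (Σv²-total (λ u v → [ lt u v ∧ G u v ])) ⟩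
      + 2 * total (λ u v → ⟦ lt u v ∧ G u v ⟧)
        ≡⟨ cong (_*_ (+ 2)) (total-cong (λ u v → ⟦∧⟧ (lt u v) (G u v))) ⟩
      + 2 * total (λ u v → ⟦<⟧ u v * A u v)
        ≡⟨ total-symmetric A A-symmetric A-loopless ⟨
      total A
        ∎

    M2-degForm : + 2 * + M2 G ≡ degForm A
    M2-degForm = begin
      + 2 * + M2 G
        ≡⟨ cong (_*_ (+ 2)) (trans (Σv²-total (λ u v → if lt u v ∧ G u v then degree G u ℕ.* degree G v else 0))
                                   (total-cong ordered-term)) ⟩
      + 2 * total (λ u v → ⟦<⟧ u v * (A u v * (deg A u * deg A v)))
        ≡⟨ total-symmetric (λ u v → A u v * (deg A u * deg A v))
             (λ u v → cong₂ _*_ (A-symmetric u v) (ℤ.*-comm (deg A u) (deg A v)))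
             (λ u → cong (_* (deg A u * deg A u)) (A-loopless u)) ⟨
      degForm A
        ∎
      where
      ordered-term : ∀ u v → + (if lt u v ∧ G u v then degree G u ℕ.* degree G v else 0)
                             ≡ ⟦<⟧ u v * (A u v * (deg A u * deg A v))
      ordered-term u v = trans (⟦if⟧ (lt u v ∧ G u v) (degree G u ℕ.* degree G v))
        (trans (cong₂ _*_ (⟦∧⟧ (lt u v) (G u v))
                          (trans (ℤ.pos-* (degree G u) (degree G v))
                                 (cong₂ _*_ (degree≡deg G u) (degree≡deg G v))))
               (ℤ.*-assoc (⟦<⟧ u v) (A u v) (deg A u * deg A v)))

    k3-cubeTrace : + 6 * + k3 G ≡ cubeTrace A
    k3-cubeTrace = begin
      + 6 * + k3 G
        ≡⟨ cong (_*_ (+ 6)) (trans (Σv³-∑³ (λ u v w → [ lt u v ∧ lt v w ∧ G u v ∧ G v w ∧ G u w ]))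
                                   (∑³-cong ordered-term)) ⟩
      + 6 * ∑³ (λ u v w → ⟦<⟧ u v * ⟦<⟧ v w * triangle u v w)
        ≡⟨ ∑³-symmetric triangle swap₁₂ swap₂₃ vanish ⟨
      ∑³ triangle
        ≡⟨ tr³-∑³ A A A ⟨
      cubeTrace A
        ∎
      where
      triangle : Fin n → Fin n → Fin n → ℤ
      triangle u v w = A u v * (A v w * A w u)
      ⟦∧⟧³ : ∀ x y z → ⟦ x ∧ y ∧ z ⟧ ≡ ⟦ x ⟧ * (⟦ y ⟧ * ⟦ z ⟧)
      ⟦∧⟧³ x y z = trans (⟦∧⟧ x (y ∧ z)) (cong (_*_ ⟦ x ⟧) (⟦∧⟧ y z))
      ordered-term : ∀ u v w → ⟦ lt u v ∧ lt v w ∧ G u v ∧ G v w ∧ G u w ⟧ ≡ ⟦<⟧ u v * ⟦<⟧ v w * triangle u v w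
      ordered-term u v w = trans (⟦∧⟧³ (lt u v) (lt v w) (G u v ∧ G v w ∧ G u w))
        (trans (sym (ℤ.*-assoc (⟦<⟧ u v) (⟦<⟧ v w) _))
               (cong (_*_ (⟦<⟧ u v * ⟦<⟧ v w))
                     (trans (⟦∧⟧³ (G u v) (G v w) (G u w))
                            (cong (λ z → A u v * (A v w * z)) (A-symmetric u w)))))
      swap₁₂ : ∀ u v w → triangle u v w ≡ triangle v u w
      swap₁₂ u v w = trans (cong (_*_ (A u v)) (ℤ.*-comm (A v w) (A w u)))
                           (cong₂ _*_ (A-symmetric u v) (cong₂ _*_ (A-symmetric w u) (A-symmetric v w)))
      swap₂₃ : ∀ u v w → triangle u v w ≡ triangle u w v
      swap₂₃ u v w = trans (reverse (A u v) (A v w) (A w u))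
                           (cong₂ _*_ (A-symmetric w u) (cong₂ _*_ (A-symmetric v w) (A-symmetric u v)))
        where
        reverse : ∀ a b c → a * (b * c) ≡ c * (b * a)
        reverse = solve-∀
      vanish : ∀ u w → triangle u u w ≡ 0ℤ
      vanish u w = cong (_* (A u w * A w u)) (A-loopless u)

    twice-H : + 2 * H G ≡ degForm A - + 2 * cubeTrace A
    twice-H = begin
      + 2 * (+ M2 G - + (6 ℕ.* k3 G))            ≡⟨ cong (λ t → + 2 * (+ M2 G - t)) (ℤ.pos-* 6 (k3 G)) ⟩
      + 2 * (+ M2 G - + 6 * + k3 G)              ≡⟨ distrib (+ M2 G) (+ k3 G) ⟩
      + 2 * + M2 G - + 2 * (+ 6 * + k3 G)        ≡⟨ cong₂ (λ p t → p - + 2 * t) M2-degForm k3-cubeTrace ⟩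
      degForm A - + 2 * cubeTrace A              ∎
      where
      distrib : ∀ p t → + 2 * (p - + 6 * t) ≡ + 2 * p - + 2 * (+ 6 * t)
      distrib = solve-∀

    private
      N : ℤ
      N = + n - 1ℤ

    degForm-compl : degForm (adjacency (compl G)) ≡
      (+ n * N - total A) * (+ n * N - total A) - (+ n * (N * N) - (N + N) * total A + M₁ A)
        - (N * N * total A - (N + N) * M₁ A + degForm A)
    degForm-compl =
      trans (degForm-cong adjacency-compl)
            (trans (degForm-complete⊖ adjacency-isAdjacency)
                   (cong (λ m → square - m - rest) (M₁-complete⊖ adjacency-isAdjacency)))
      where
      square rest : ℤ
      square = (+ n * N - total A) * (+ n * N - total A)
      rest   = N * N * total A - (N + N) * M₁ A + degForm A

    cubeTrace-compl : cubeTrace (adjacency (compl G)) ≡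
      (+ n - + 2) * (+ n * N) - + 3 * ((+ n - + 2) * total A) + + 3 * (M₁ A - total A) - cubeTrace A
    cubeTrace-compl = trans (cubeTrace-cong adjacency-compl) (cubeTrace-complete⊖ adjacency-isAdjacency)

  twice-C₂ : ∀ n → + 2 * + (n C 2) ≡ + n * (+ n - 1ℤ)
  twice-C₂ zero    = refl
  twice-C₂ (suc n) = begin
    + 2 * + (suc n C 2)                ≡⟨ cong (λ k → + 2 * + k) (nCk+nC[k+1]≡[n+1]C[k+1] n 1) ⟨
    + 2 * + (n C 1 ℕ.+ n C 2)          ≡⟨ cong (_*_ (+ 2)) (ℤ.pos-+ (n C 1) (n C 2)) ⟩
    + 2 * (+ (n C 1) + + (n C 2))      ≡⟨ cong (λ k → + 2 * (+ k + + (n C 2))) (nC1≡n n) ⟩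
    + 2 * (+ n + + (n C 2))            ≡⟨ ℤ.*-distribˡ-+ (+ 2) (+ n) (+ (n C 2)) ⟩
    + 2 * + n + + 2 * + (n C 2)        ≡⟨ cong (_+_ (+ 2 * + n)) (twice-C₂ n) ⟩
    + 2 * + n + + n * (+ n - 1ℤ)       ≡⟨ step (+ n) ⟩
    + suc n * (+ suc n - 1ℤ)           ∎
    where
    step : ∀ k → + 2 * k + k * (k - 1ℤ) ≡ (1ℤ + k) * (1ℤ + k - 1ℤ)
    step = solve-∀

  six-C₃ : ∀ n → + 6 * + (n C 3) ≡ + n * (+ n - 1ℤ) * (+ n - + 2)
  six-C₃ zero    = refl
  six-C₃ (suc n) = begin
    + 6 * + (suc n C 3)
      ≡⟨ cong (λ k → + 6 * + k) (nCk+nC[k+1]≡[n+1]C[k+1] n 2) ⟨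
    + 6 * + (n C 2 ℕ.+ n C 3)
      ≡⟨ cong (_*_ (+ 6)) (ℤ.pos-+ (n C 2) (n C 3)) ⟩
    + 6 * (+ (n C 2) + + (n C 3))
      ≡⟨ split (+ (n C 2)) (+ (n C 3)) ⟩
    + 3 * (+ 2 * + (n C 2)) + + 6 * + (n C 3)
      ≡⟨ cong₂ (λ p q → + 3 * p + q) (twice-C₂ n) (six-C₃ n) ⟩
    + 3 * (+ n * (+ n - 1ℤ)) + + n * (+ n - 1ℤ) * (+ n - + 2)
      ≡⟨ step (+ n) ⟩
    + suc n * (+ suc n - 1ℤ) * (+ suc n - + 2)
      ∎
    where
    split : ∀ x y → + 6 * (x + y) ≡ + 3 * (+ 2 * x) + + 6 * y
    split = solve-∀
    step : ∀ k → + 3 * (k * (k - 1ℤ)) + k * (k - 1ℤ) * (k - + 2) ≡ (1ℤ + k) * (1ℤ + k - 1ℤ) * (1ℤ + k - + 2)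
    step = solve-∀

  h-doubled : ℤ → ℤ → ℤ
  h-doubled k D = D * D - + 2 * (k * (k - 1ℤ) * (k - + 2)) + (k - 1ℤ) * (k - 1ℤ) * (k * (k - 1ℤ))
                  - + 3 * (k - 1ℤ) * (k - + 3) * D

  twice-h : ∀ n m → + 2 * h n m ≡ h-doubled (+ n) (+ 2 * + m)
  twice-h n m = begin
    + 2 * h n m
      ≡⟨ cong₂ (λ p q → + 2 * (p - q + N * N * + (n C 2) - + 3 * N * (+ n - + 3) * + m))
               (trans (ℤ.pos-* (2 ℕ.* m) m) (cong (_* + m) (ℤ.pos-* 2 m))) (ℤ.pos-* 6 (n C 3)) ⟩
    + 2 * (+ 2 * + m * + m - + 6 * + (n C 3) + N * N * + (n C 2) - + 3 * N * (+ n - + 3) * + m)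
      ≡⟨ distrib (+ n) (+ m) (+ (n C 2)) (+ (n C 3)) ⟩
    (+ 2 * + m) * (+ 2 * + m) - + 2 * (+ 6 * + (n C 3)) + N * N * (+ 2 * + (n C 2))
      - + 3 * N * (+ n - + 3) * (+ 2 * + m)
      ≡⟨ cong₂ (λ p q → (+ 2 * + m) * (+ 2 * + m) - + 2 * p + N * N * q - + 3 * N * (+ n - + 3) * (+ 2 * + m))
               (six-C₃ n) (twice-C₂ n) ⟩
    h-doubled (+ n) (+ 2 * + m)
      ∎
    where
    N : ℤ
    N = + n - 1ℤ
    distrib : ∀ k m c₂ c₃ →
      + 2 * (+ 2 * m * m - + 6 * c₃ + (k - 1ℤ) * (k - 1ℤ) * c₂ - + 3 * (k - 1ℤ) * (k - + 3) * m)
      ≡ (+ 2 * m) * (+ 2 * m) - + 2 * (+ 6 * c₃) + (k - 1ℤ) * (k - 1ℤ) * (+ 2 * c₂)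
        - + 3 * (k - 1ℤ) * (k - + 3) * (+ 2 * m)
    distrib = solve-∀

  H-sum-polynomial : ∀ k d m p t →
    p - + 2 * t
      + ((k * (k - 1ℤ) - d) * (k * (k - 1ℤ) - d) - (k * ((k - 1ℤ) * (k - 1ℤ)) - ((k - 1ℤ) + (k - 1ℤ)) * d + m)
          - ((k - 1ℤ) * (k - 1ℤ) * d - ((k - 1ℤ) + (k - 1ℤ)) * m + p)
         - + 2 * ((k - + 2) * (k * (k - 1ℤ)) - + 3 * ((k - + 2) * d) + + 3 * (m - d) - t))
    ≡ (+ 2 * k - + 9) * m + (d * d - + 2 * (k * (k - 1ℤ) * (k - + 2)) + (k - 1ℤ) * (k - 1ℤ) * (k * (k - 1ℤ))
                             - + 3 * (k - 1ℤ) * (k - + 3) * d)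
  H-sum-polynomial = solve-∀

  twice-H-sum : {G : Adj n} → IsSimple G →
    + 2 * (H G + H (compl G)) ≡ (+ 2 * + n - + 9) * + M1 G + + 2 * h n (edges G)
  twice-H-sum {n} {G} simple = begin
    + 2 * (H G + H (compl G))
      ≡⟨ ℤ.*-distribˡ-+ (+ 2) (H G) (H (compl G)) ⟩
    + 2 * H G + + 2 * H (compl G)
      ≡⟨ cong₂ _+_ (twice-H simple) (twice-H (compl-isSimple simple)) ⟩
    degForm A - + 2 * cubeTrace A + (degForm (adjacency (compl G)) - + 2 * cubeTrace (adjacency (compl G)))
      ≡⟨ trans (cong₂ (λ p t → degForm A - + 2 * cubeTrace A + (p - + 2 * t))
                      (degForm-compl simple) (cubeTrace-compl simple))
               (H-sum-polynomial (+ n) (total A) (M₁ A) (degForm A) (cubeTrace A)) ⟩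
    (+ 2 * + n - + 9) * M₁ A + h-doubled (+ n) (total A)
      ≡⟨ cong₂ (λ M D → (+ 2 * + n - + 9) * M + h-doubled (+ n) D) (M1≡M₁ G) (edges-total simple) ⟨
    (+ 2 * + n - + 9) * + M1 G + h-doubled (+ n) (+ 2 * + edges G)
      ≡⟨ cong (_+_ ((+ 2 * + n - + 9) * + M1 G)) (twice-h n (edges G)) ⟨
    (+ 2 * + n - + 9) * + M1 G + + 2 * h n (edges G)
      ∎
    where
    A : Matrix n
    A = adjacency G


open import Data.Integer as ℤ using (ℤ)
open import Data.Integer.Tactic.RingSolver using (solve-∀)
open import Data.Rational using (_+_; _*_; _-_; _/_; -_; toℚᵘ)
open import Data.Rational.Properties using (toℚᵘ-injective; toℚᵘ-fromℚᵘ; toℚᵘ-homo-+; toℚᵘ-homo-*; toℚᵘ-homo‿-)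
open import Data.Rational.Unnormalised as ℚᵘ using (mkℚᵘ; *≡*; _≃_)
import Data.Rational.Unnormalised.Properties as ℚᵘ

toℚᵘ-ι : (z : ℤ) → toℚᵘ (ι z) ≃ mkℚᵘ z 0
toℚᵘ-ι z = toℚᵘ-fromℚᵘ (mkℚᵘ z 0)

ι-transfer : (x y k m c : ℤ) → + 2 ℤ.* (x ℤ.+ y) ≡ (+ 2 ℤ.* k ℤ.- + 9) ℤ.* m ℤ.+ + 2 ℤ.* c →
  ι x + ι y ≡ (ι k - + 9 / 2) * ι m + ι c
ι-transfer x y k m c doubled = toℚᵘ-injective (begin
  toℚᵘ (ι x + ι y)
    ≈⟨ toℚᵘ-homo-+ (ι x) (ι y) ⟩
  toℚᵘ (ι x) ℚᵘ.+ toℚᵘ (ι y)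
    ≈⟨ ℚᵘ.+-cong (toℚᵘ-ι x) (toℚᵘ-ι y) ⟩
  mkℚᵘ x 0 ℚᵘ.+ mkℚᵘ y 0
    ≈⟨ *≡* (trans (cross-lhs x y) (trans doubled (cross-rhs k m c))) ⟩
  (mkℚᵘ k 0 ℚᵘ.- mkℚᵘ (+ 9) 1) ℚᵘ.* mkℚᵘ m 0 ℚᵘ.+ mkℚᵘ c 0
    ≈⟨ ℚᵘ.+-cong (ℚᵘ.*-cong coefficient (toℚᵘ-ι m)) (toℚᵘ-ι c) ⟨
  toℚᵘ (ι k - + 9 / 2) ℚᵘ.* toℚᵘ (ι m) ℚᵘ.+ toℚᵘ (ι c)
    ≈⟨ ℚᵘ.+-cong (toℚᵘ-homo-* (ι k - + 9 / 2) (ι m)) ℚᵘ.≃-refl ⟨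
  toℚᵘ ((ι k - + 9 / 2) * ι m) ℚᵘ.+ toℚᵘ (ι c)
    ≈⟨ toℚᵘ-homo-+ ((ι k - + 9 / 2) * ι m) (ι c) ⟨
  toℚᵘ ((ι k - + 9 / 2) * ι m + ι c)
    ∎)
  where
  open ℚᵘ.≃-Reasoning
  coefficient : toℚᵘ (ι k - + 9 / 2) ≃ mkℚᵘ k 0 ℚᵘ.- mkℚᵘ (+ 9) 1
  coefficient = ℚᵘ.≃-trans (toℚᵘ-homo-+ (ι k) (- (+ 9 / 2))) (ℚᵘ.+-cong (toℚᵘ-ι k) (toℚᵘ-homo‿- (+ 9 / 2)))
  -- *≡* cross-multiplies: each numerator times the other side's denominator (2, resp. 1).
  cross-lhs : ∀ x y → (x ℤ.* + 1 ℤ.+ y ℤ.* + 1) ℤ.* + 2 ≡ + 2 ℤ.* (x ℤ.+ y)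
  cross-lhs = solve-∀
  cross-rhs : ∀ k m c → (+ 2 ℤ.* k ℤ.- + 9) ℤ.* m ℤ.+ + 2 ℤ.* c
                      ≡ ((k ℤ.* + 2 ℤ.+ ℤ.- + 9 ℤ.* + 1) ℤ.* m ℤ.* + 1 ℤ.+ c ℤ.* + 2) ℤ.* + 1
  cross-rhs = solve-∀

lemma13 : (n m : ℕ) → 5 ≤ n → m ≤ n C 2 →
    (G : Adj n) → IsSimple G → edges G ≡ m →
    ι (H G) + ι (H (compl G)) ≡ (ι (+ n) - (+ 9 / 2)) * ι (+ M1 G) + ι (h n m)
lemma13 n m _ _ G simple refl =
  ι-transfer (H G) (H (compl G)) (+ n) (+ M1 G) (h n m) (twice-H-sum simple)
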